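{- Let $\Delta$ be a finite pure simplicial complex labelled by a set $I$, equipped with maps $R_C:\mathcal{C}\to\mathcal{F}$ ($C\in\mathcal{C}$) satisfying the restriction axioms (R1)–(R3). Fix a chamber $C$ and for $J\subseteq I$ put $\beta_J=|\{D\in\mathcal{C}: R_C(D)\text{ has type }J\}|$. Then $\beta_J=h_J(\Delta)$ for every $J\subseteq I$.
   Context: $\mathcal{F}$ is the set of faces (including $\emptyset$), $\mathcal{C}$ the set of chambers (maximal faces), $\le$ the face relation. A labelling by $I$ assigns to each vertex an element of $I$ so that the vertices of every chamber are mapped bijectively onto $I$; the type of a face is its set of labels. Axioms: (R1) $R_C(C)=\emptyset$ and $R_C(D)\le D$; (R2) for each $C$, $\mathcal{F}$ is the disjoint union over $D\in\mathcal{C}$ of $\{F: R_C(D)\le F\le D\}$; (R3) if $C_1,\dots,C_n=D$ are chambers with $R_C(C_i)\le C_{i+1}$ for $1\le i<n$ then $R_{C_1}(D)\le R_C(D)\le D$. The flag $f$-vector: $f_J(\Delta)$ is the number of faces of type $J$; the flag $h$-vector is defined by $h_J(\Delta)=\sum_{K\subseteq J}(-1)^{|J-K|}f_K(\Delta)$, equivalently $f_J=\sum_{K\subseteq J}h_K$. -}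

module Defs where

open import Level using (0ℓ)
open import Data.Nat using (ℕ; zero; suc; _+_)
open import Data.Integer using (ℤ; +_; -1ℤ; 0ℤ; _^_) renaming (_+_ to _+ℤ_; _*_ to _*ℤ_)
open import Data.Bool using (Bool; true; false; if_then_else_)
open import Data.Vec using (Vec; []; _∷_; tabulate)
open import Data.Vec.Properties using (≡-dec)
open import Data.Fin using (Fin) renaming (_≟_ to _≟ᶠ_)
open import Data.Fin.Properties using (any?)
open import Data.Fin.Subset using (Subset; ⊥; ⁅_⁆; _∈_; _⊆_; _⊂_; _─_; ∣_∣; inside; outside)
open import Data.Fin.Subset.Properties using (_∈?_; _⊆?_; _⊂?_; anySubset?)
open import Data.Product using (Σ; ∃; ∃-syntax; _×_; _,_)
open import Data.Product.Properties using () 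
open import Data.List using (List; []; _∷_)
open import Data.List.Relation.Unary.All using (All)
open import Data.Unit using (⊤)
open import Relation.Nullary using (¬_; Dec; yes; no)
open import Relation.Nullary.Decidable using (⌊_⌋; _×-dec_; ¬?)
open import Relation.Unary using (Pred; Decidable)
open import Relation.Binary.PropositionalEquality using (_≡_)
import Data.Bool as B

_≟ˢ_ : ∀ {n} (p q : Subset n) → Dec (p ≡ q)
_≟ˢ_ = ≡-dec B._≟_

countSubsets : ∀ {n} {P : Pred (Subset n) 0ℓ} → Decidable P → ℕ
countSubsets {zero}  P? = if ⌊ P? [] ⌋ then 1 else 0
countSubsets {suc n} P? = countSubsets (λ p → P? (inside ∷ p)) + countSubsets (λ p → P? (outside ∷ p))

sumSubsets : ∀ {n} → (Subset n → ℤ) → ℤ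
sumSubsets {zero}  f = f []
sumSubsets {suc n} f = sumSubsets (λ p → f (inside ∷ p)) +ℤ sumSubsets (λ p → f (outside ∷ p))

record SimplicialComplex (n : ℕ) : Set₁ where
  field
    IsFace      : Pred (Subset n) 0ℓ
    isFace?     : Decidable IsFace
    empty-face  : IsFace ⊥
    vertex-face : ∀ v → IsFace ⁅ v ⁆
    down-closed : ∀ {F G} → IsFace G → F ⊆ G → IsFace F

  IsChamber : Pred (Subset n) 0ℓ
  IsChamber D = IsFace D × ¬ (∃[ G ] (IsFace G × D ⊂ G))

  isChamber? : Decidable IsChamber
  isChamber? D = isFace? D ×-dec ¬? (anySubset? (λ G → isFace? G ×-dec (D ⊂? G)))

  IsPure : Set
  IsPure = ∀ {C D} → IsChamber C → IsChamber D → ∣ C ∣ ≡ ∣ D ∣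

open SimplicialComplex public

type : ∀ {n m} → (Fin n → Fin m) → Subset n → Subset m
type ℓ F = tabulate (λ i → ⌊ any? (λ v → (v ∈? F) ×-dec (ℓ v ≟ᶠ i)) ⌋)

IsLabelling : ∀ {n m} → SimplicialComplex n → (Fin n → Fin m) → Set
IsLabelling {n} {m} Δ ℓ =
  ∀ {D} → IsChamber Δ D →
    (∀ (i : Fin m) → ∃[ v ] (v ∈ D × ℓ v ≡ i)) ×
    (∀ {u v} → u ∈ D → v ∈ D → ℓ u ≡ ℓ v → u ≡ v)

flagF : ∀ {n m} → SimplicialComplex n → (Fin n → Fin m) → Subset m → ℕ
flagF Δ ℓ J = countSubsets (λ F → isFace? Δ F ×-dec (type ℓ F ≟ˢ J))

flagH : ∀ {n m} → SimplicialComplex n → (Fin n → Fin m) → Subset m → ℤ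
flagH Δ ℓ J =
  sumSubsets (λ K → if ⌊ K ⊆? J ⌋ then (-1ℤ ^ ∣ J ─ K ∣) *ℤ (+ flagF Δ ℓ K) else 0ℤ)

-- Restriction maps R_C (C a chamber), written R C D = R_C(D).

RChain : ∀ {n} → (Subset n → Subset n → Subset n) → Subset n → Subset n → List (Subset n) → Set
RChain R C x []       = ⊤
RChain R C x (y ∷ ys) = R C x ⊆ y × RChain R C y ys

lastOf : ∀ {A : Set} → A → List A → A
lastOf x []       = x
lastOf x (y ∷ ys) = lastOf y ys

record IsRestriction {n : ℕ} (Δ : SimplicialComplex n)
                     (R : Subset n → Subset n → Subset n) : Set where
  field
    R1-self : ∀ {C} → IsChamber Δ C → R C C ≡ ⊥
    R1-le   : ∀ {C D} → IsChamber Δ C → IsChamber Δ D → R C D ⊆ D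
    -- (R2): the faces are the disjoint union of the intervals [R_C(D), D]
    R2-cover  : ∀ {C} → IsChamber Δ C → ∀ {F} → IsFace Δ F →
                ∃[ D ] (IsChamber Δ D × R C D ⊆ F × F ⊆ D)
    R2-unique : ∀ {C D D′ F} → IsChamber Δ C → IsChamber Δ D → IsChamber Δ D′ →
                R C D ⊆ F → F ⊆ D → R C D′ ⊆ F → F ⊆ D′ → D ≡ D′
    R3 : ∀ {C C₁ rest} → IsChamber Δ C → IsChamber Δ C₁ → All (IsChamber Δ) rest →
         RChain R C C₁ rest →
         (R C₁ (lastOf C₁ rest) ⊆ R C (lastOf C₁ rest)) × (R C (lastOf C₁ rest) ⊆ lastOf C₁ rest)

beta : ∀ {n m} → (Δ : SimplicialComplex n) → (Fin n → Fin m) →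
       (Subset n → Subset n → Subset n) → Subset n → Subset m → ℕ
beta Δ ℓ R C J = countSubsets (λ D → isChamber? Δ D ×-dec (type ℓ (R C D) ≟ˢ J))

{-# OPTIONS --safe #-}
module Submission where

-- Axiom (R2) partitions the faces into the intervals [R_C(D), D], D a chamber.
-- The vertices of a chamber carry pairwise distinct labels covering I, so the
-- interval of D contains exactly one face of type K when type(R_C(D)) ⊆ K and
-- none otherwise. Hence f_K = Σ_{L ⊆ K} β_L, and Möbius inversion on the
-- Boolean lattice of subsets of I turns this into β_J = h_J.

open import Defs
open import Level using (0ℓ)
open import Data.Nat using (ℕ; zero; suc)
open import Data.Integer using (ℤ; +_; -1ℤ; 0ℤ; 1ℤ; _^_; _+_; _*_)
open import Data.Integer.Properties
  using (+-identityˡ; +-identityʳ; *-comm; *-identityˡ; *-zeroʳ; *-distribˡ-+)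
open import Data.Integer.Tactic.RingSolver using (solve-∀)
open import Data.Bool using (if_then_else_)
open import Data.Vec using ([]; _∷_; tabulate)
open import Data.Vec.Properties using (∷-injectiveʳ; []=⇒lookup; lookup⇒[]=; lookup∘tabulate)
open import Data.Fin using (Fin) renaming (_≟_ to _≟ᶠ_)
open import Data.Fin.Properties using (any?)
open import Data.Fin.Subset using (Subset; inside; outside; _∈_; _⊆_; _∩_; _─_; ∣_∣)
open import Data.Fin.Subset.Properties
  using (_∈?_; _⊆?_; ⊆-reflexive; ⊆-antisym; p∩q⊆p; x∈p∩q⁺; x∈p∩q⁻; anySubset?)
open import Data.Product using (∃; ∃-syntax; _×_; _,_; proj₁; proj₂)
open import Data.Empty using (⊥-elim)
open import Function using (_∘_)
open import Function.Bundles using (_⇔_; mk⇔; Equivalence)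
open import Relation.Nullary using (¬_; Dec; yes; no; does)
open import Relation.Nullary.Decidable using (⌊_⌋; _×-dec_; isYes≗does; dec-true)
open import Relation.Unary using (Pred; Decidable)
open import Relation.Binary.PropositionalEquality
open ≡-Reasoning

∑ : ∀ {n} → (Subset n → ℤ) → ℤ
∑ = sumSubsets

infix 5 ∑
syntax ∑ (λ x → e) = ∑[ x ] e

∑-cong : ∀ {n} {f g : Subset n → ℤ} → (∀ x → f x ≡ g x) → ∑ f ≡ ∑ g
∑-cong {zero}  f≡g = f≡g []
∑-cong {suc n} f≡g = cong₂ _+_ (∑-cong (f≡g ∘ (inside ∷_))) (∑-cong (f≡g ∘ (outside ∷_)))

∑-zero : ∀ {n} {f : Subset n → ℤ} → (∀ x → f x ≡ 0ℤ) → ∑ f ≡ 0ℤ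
∑-zero {zero}  f≡0 = f≡0 []
∑-zero {suc n} f≡0 = cong₂ _+_ (∑-zero (f≡0 ∘ (inside ∷_))) (∑-zero (f≡0 ∘ (outside ∷_)))

∑-+ : ∀ {n} (f g : Subset n → ℤ) → ∑[ x ] (f x + g x) ≡ ∑ f + ∑ g
∑-+ {zero}  f g = refl
∑-+ {suc n} f g = trans (cong₂ _+_ (∑-+ f₁ g₁) (∑-+ f₀ g₀)) (interchange (∑ f₁) (∑ g₁) (∑ f₀) (∑ g₀))
  where
  f₁ g₁ f₀ g₀ : Subset n → ℤ
  f₁ = f ∘ (inside ∷_)
  g₁ = g ∘ (inside ∷_)
  f₀ = f ∘ (outside ∷_)
  g₀ = g ∘ (outside ∷_)
  interchange : ∀ a b c d → (a + b) + (c + d) ≡ (a + c) + (b + d)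
  interchange = solve-∀

∑-*ˡ : ∀ {n} (c : ℤ) (f : Subset n → ℤ) → ∑[ x ] c * f x ≡ c * ∑ f
∑-*ˡ {zero}  c f = refl
∑-*ˡ {suc n} c f = trans
  (cong₂ _+_ (∑-*ˡ c (f ∘ (inside ∷_))) (∑-*ˡ c (f ∘ (outside ∷_))))
  (sym (*-distribˡ-+ c _ _))

∑-*ʳ : ∀ {n} (c : ℤ) (f : Subset n → ℤ) → ∑[ x ] f x * c ≡ ∑ f * c
∑-*ʳ c f = trans (∑-cong (λ x → *-comm (f x) c)) (trans (∑-*ˡ c f) (*-comm c (∑ f)))

∑-δ : ∀ {n} (f : Subset n → ℤ) (x : Subset n) → (∀ y → y ≢ x → f y ≡ 0ℤ) → ∑ f ≡ f x
∑-δ {zero}  f [] _ = refl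
∑-δ {suc n} f (inside ∷ x) vanish = trans
  (cong₂ _+_ (∑-δ (f ∘ (inside ∷_)) x (λ y y≢x → vanish (inside ∷ y) (y≢x ∘ ∷-injectiveʳ)))
             (∑-zero (λ y → vanish (outside ∷ y) (λ ()))))
  (+-identityʳ _)
∑-δ {suc n} f (outside ∷ x) vanish = trans
  (cong₂ _+_ (∑-zero (λ y → vanish (inside ∷ y) (λ ())))
             (∑-δ (f ∘ (outside ∷_)) x (λ y y≢x → vanish (outside ∷ y) (y≢x ∘ ∷-injectiveʳ))))
  (+-identityˡ _)

∑-comm : ∀ {a b} (f : Subset a → Subset b → ℤ) → ∑[ x ] ∑[ y ] f x y ≡ ∑[ y ] ∑[ x ] f x y
∑-comm {zero}  f = refl
∑-comm {suc a} f = trans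
  (cong₂ _+_ (∑-comm (f ∘ (inside ∷_))) (∑-comm (f ∘ (outside ∷_))))
  (sym (∑-+ (λ y → ∑[ x ] f (inside ∷ x) y) (λ y → ∑[ x ] f (outside ∷ x) y)))

𝟙 : ∀ {A : Set} → Dec A → ℤ
𝟙 a? = if does a? then 1ℤ else 0ℤ

𝟙-yes : ∀ {A : Set} (a? : Dec A) → A → 𝟙 a? ≡ 1ℤ
𝟙-yes (yes _) _ = refl
𝟙-yes (no ¬a) a = ⊥-elim (¬a a)

𝟙-no : ∀ {A : Set} (a? : Dec A) → ¬ A → 𝟙 a? ≡ 0ℤ
𝟙-no (yes a) ¬a = ⊥-elim (¬a a)
𝟙-no (no _)  _  = refl

𝟙-× : ∀ {A B : Set} (a? : Dec A) (b? : Dec B) → 𝟙 (a? ×-dec b?) ≡ 𝟙 a? * 𝟙 b?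
𝟙-× (yes _) (yes _) = refl
𝟙-× (yes _) (no _)  = refl
𝟙-× (no _)  _       = refl

if-⌊⌋-then-else-0 : ∀ {A : Set} (a? : Dec A) (x : ℤ) → (if ⌊ a? ⌋ then x else 0ℤ) ≡ 𝟙 a? * x
if-⌊⌋-then-else-0 (yes _) x = sym (*-identityˡ x)
if-⌊⌋-then-else-0 (no _)  x = refl

+-countSubsets : ∀ {n} {P : Pred (Subset n) 0ℓ} (P? : Decidable P) →
                 + countSubsets P? ≡ ∑[ x ] 𝟙 (P? x)
+-countSubsets {zero} P? with P? []
... | yes _ = refl
... | no _  = refl
+-countSubsets {suc n} P? =
  cong₂ _+_ (+-countSubsets (P? ∘ (inside ∷_))) (+-countSubsets (P? ∘ (outside ∷_)))

∑-𝟙-unique : ∀ {n} {P : Pred (Subset n) 0ℓ} {Q : Set} (P? : Decidable P) (Q? : Dec Q) →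
             (∀ {x y} → P x → P y → x ≡ y) → ∃ P ⇔ Q → ∑[ x ] 𝟙 (P? x) ≡ 𝟙 Q?
∑-𝟙-unique P? Q? unique ∃P⇔Q with anySubset? P?
... | yes (x , px) = begin
  ∑[ y ] 𝟙 (P? y) ≡⟨ ∑-δ (𝟙 ∘ P?) x (λ y y≢x → 𝟙-no (P? y) (λ py → y≢x (unique py px))) ⟩
  𝟙 (P? x)        ≡⟨ 𝟙-yes (P? x) px ⟩
  1ℤ              ≡⟨ 𝟙-yes Q? (Equivalence.to ∃P⇔Q (x , px)) ⟨
  𝟙 Q?            ∎
... | no ∄x = begin
  ∑[ y ] 𝟙 (P? y) ≡⟨ ∑-zero (λ y → 𝟙-no (P? y) (λ py → ∄x (y , py))) ⟩
  0ℤ              ≡⟨ 𝟙-no Q? (∄x ∘ Equivalence.from ∃P⇔Q) ⟨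
  𝟙 Q?            ∎

∑-alternating : ∀ {m} (L J : Subset m) →
                ∑[ K ] 𝟙 (K ⊆? J) * ((-1ℤ ^ ∣ J ─ K ∣) * 𝟙 (L ⊆? K)) ≡ 𝟙 (L ≟ˢ J)
∑-alternating [] [] = refl
∑-alternating (inside ∷ L) (inside ∷ J) =
  trans (cong₂ _+_ (∑-alternating L J) (∑-zero L⊈K)) (+-identityʳ _)
  where
  L⊈K : ∀ K → 𝟙 (K ⊆? J) * ((-1ℤ * (-1ℤ ^ ∣ J ─ K ∣)) * 0ℤ) ≡ 0ℤ
  L⊈K K = trans (cong (𝟙 (K ⊆? J) *_) (*-zeroʳ (-1ℤ * (-1ℤ ^ ∣ J ─ K ∣))))
                (*-zeroʳ (𝟙 (K ⊆? J)))
∑-alternating (inside ∷ L) (outside ∷ J) = ∑-zero L⊈K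
  where
  L⊈K : ∀ K → 𝟙 (K ⊆? (outside ∷ J)) * ((-1ℤ ^ ∣ (outside ∷ J) ─ K ∣) * 𝟙 ((inside ∷ L) ⊆? K))
              ≡ 0ℤ
  L⊈K (inside ∷ K)  = refl
  L⊈K (outside ∷ K) = trans (cong (𝟙 (K ⊆? J) *_) (*-zeroʳ (-1ℤ ^ ∣ J ─ K ∣)))
                            (*-zeroʳ (𝟙 (K ⊆? J)))
-- Adding the new point to K flips the sign, so the two halves of the sum cancel.
∑-alternating {suc m} (outside ∷ L) (inside ∷ J) = begin
  S + (∑[ K ] 𝟙 (K ⊆? J) * ((-1ℤ * s K) * 𝟙 (L ⊆? K)))
    ≡⟨ cong (_+_ S) (∑-cong (λ K → pull-sign (𝟙 (K ⊆? J)) (s K) (𝟙 (L ⊆? K)))) ⟩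
  S + (∑[ K ] -1ℤ * (𝟙 (K ⊆? J) * (s K * 𝟙 (L ⊆? K))))
    ≡⟨ cong (_+_ S) (∑-*ˡ -1ℤ (λ K → 𝟙 (K ⊆? J) * (s K * 𝟙 (L ⊆? K)))) ⟩
  S + -1ℤ * S
    ≡⟨ cancel S ⟩
  0ℤ ∎
  where
  s : Subset m → ℤ
  s K = -1ℤ ^ ∣ J ─ K ∣
  S : ℤ
  S = ∑[ K ] 𝟙 (K ⊆? J) * (s K * 𝟙 (L ⊆? K))
  pull-sign : ∀ a b c → a * ((-1ℤ * b) * c) ≡ -1ℤ * (a * (b * c))
  pull-sign = solve-∀
  cancel : ∀ x → x + -1ℤ * x ≡ 0ℤ
  cancel = solve-∀
∑-alternating (outside ∷ L) (outside ∷ J) =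
  trans (cong₂ _+_ (∑-zero K⊈J) (∑-alternating L J)) (+-identityˡ _)
  where
  K⊈J : ∀ K → 𝟙 ((inside ∷ K) ⊆? (outside ∷ J)) * ((-1ℤ ^ ∣ J ─ K ∣) * 𝟙 (L ⊆? K))
              ≡ 0ℤ
  K⊈J _ = refl

möbiusInverse : ∀ {m} → (Subset m → ℤ) → Subset m → ℤ
möbiusInverse f J = ∑[ K ] (if ⌊ K ⊆? J ⌋ then (-1ℤ ^ ∣ J ─ K ∣) * f K else 0ℤ)

möbius-inversion : ∀ {m} (f g : Subset m → ℤ) → (∀ K → f K ≡ ∑[ L ] 𝟙 (L ⊆? K) * g L) →
                   ∀ J → möbiusInverse f J ≡ g J
möbius-inversion {m} f g f≡∑g J = begin
  möbiusInverse f J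
    ≡⟨ ∑-cong expand ⟩
  ∑[ K ] ∑[ L ] 𝟙 (K ⊆? J) * (s K * (𝟙 (L ⊆? K) * g L))
    ≡⟨ ∑-comm (λ K L → 𝟙 (K ⊆? J) * (s K * (𝟙 (L ⊆? K) * g L))) ⟩
  ∑[ L ] ∑[ K ] 𝟙 (K ⊆? J) * (s K * (𝟙 (L ⊆? K) * g L))
    ≡⟨ ∑-cong collect ⟩
  ∑[ L ] (∑[ K ] 𝟙 (K ⊆? J) * (s K * 𝟙 (L ⊆? K))) * g L
    ≡⟨ ∑-cong (λ L → cong (_* g L) (∑-alternating L J)) ⟩
  ∑[ L ] 𝟙 (L ≟ˢ J) * g L
    ≡⟨ ∑-δ (λ L → 𝟙 (L ≟ˢ J) * g L) J (λ L L≢J → cong (_* g L) (𝟙-no (L ≟ˢ J) L≢J)) ⟩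
  𝟙 (J ≟ˢ J) * g J
    ≡⟨ trans (cong (_* g J) (𝟙-yes (J ≟ˢ J) refl)) (*-identityˡ (g J)) ⟩
  g J ∎
  where
  s : Subset m → ℤ
  s K = -1ℤ ^ ∣ J ─ K ∣

  expand : ∀ K → (if ⌊ K ⊆? J ⌋ then s K * f K else 0ℤ) ≡
                 ∑[ L ] 𝟙 (K ⊆? J) * (s K * (𝟙 (L ⊆? K) * g L))
  expand K = begin
    (if ⌊ K ⊆? J ⌋ then s K * f K else 0ℤ)
      ≡⟨ if-⌊⌋-then-else-0 (K ⊆? J) (s K * f K) ⟩
    𝟙 (K ⊆? J) * (s K * f K)
      ≡⟨ cong (λ t → 𝟙 (K ⊆? J) * (s K * t)) (f≡∑g K) ⟩
    𝟙 (K ⊆? J) * (s K * (∑[ L ] 𝟙 (L ⊆? K) * g L))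
      ≡⟨ cong (𝟙 (K ⊆? J) *_) (∑-*ˡ (s K) (λ L → 𝟙 (L ⊆? K) * g L)) ⟨
    𝟙 (K ⊆? J) * (∑[ L ] s K * (𝟙 (L ⊆? K) * g L))
      ≡⟨ ∑-*ˡ (𝟙 (K ⊆? J)) (λ L → s K * (𝟙 (L ⊆? K) * g L)) ⟨
    ∑[ L ] 𝟙 (K ⊆? J) * (s K * (𝟙 (L ⊆? K) * g L)) ∎

  collect : ∀ L → ∑[ K ] 𝟙 (K ⊆? J) * (s K * (𝟙 (L ⊆? K) * g L)) ≡
                  (∑[ K ] 𝟙 (K ⊆? J) * (s K * 𝟙 (L ⊆? K))) * g L
  collect L = trans
    (∑-cong (λ K → reassociate (𝟙 (K ⊆? J)) (s K) (𝟙 (L ⊆? K)) (g L)))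
    (∑-*ʳ (g L) (λ K → 𝟙 (K ⊆? J) * (s K * 𝟙 (L ⊆? K))))
    where
    reassociate : ∀ a b c d → a * (b * (c * d)) ≡ (a * (b * c)) * d
    reassociate = solve-∀

module _ {n : ℕ} {P : Pred (Fin n) 0ℓ} (P? : Decidable P) where

  ∈-tabulate-dec⁺ : ∀ {i} → P i → i ∈ tabulate (⌊_⌋ ∘ P?)
  ∈-tabulate-dec⁺ {i} p = lookup⇒[]= i _
    (trans (lookup∘tabulate (⌊_⌋ ∘ P?) i) (trans (isYes≗does (P? i)) (dec-true (P? i) p)))

  ∈-tabulate-dec⁻ : ∀ {i} → i ∈ tabulate (⌊_⌋ ∘ P?) → P i
  ∈-tabulate-dec⁻ {i} i∈ with P? i | trans (sym (lookup∘tabulate (⌊_⌋ ∘ P?) i)) ([]=⇒lookup i∈)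
  ... | yes p | _  = p
  ... | no _  | ()

preimage : ∀ {n m} → (Fin n → Fin m) → Subset m → Subset n
preimage ℓ K = tabulate (λ v → ⌊ ℓ v ∈? K ⌋)

module _ {n m : ℕ} (ℓ : Fin n → Fin m) where

  ∈-type⁺ : ∀ {F v} → v ∈ F → ℓ v ∈ type ℓ F
  ∈-type⁺ {F} {v} v∈F =
    ∈-tabulate-dec⁺ (λ i → any? (λ u → (u ∈? F) ×-dec (ℓ u ≟ᶠ i))) (v , v∈F , refl)

  ∈-type⁻ : ∀ {F i} → i ∈ type ℓ F → ∃[ v ] (v ∈ F × ℓ v ≡ i)
  ∈-type⁻ {F} = ∈-tabulate-dec⁻ (λ i → any? (λ u → (u ∈? F) ×-dec (ℓ u ≟ᶠ i)))

  ∈-preimage⁺ : ∀ {K v} → ℓ v ∈ K → v ∈ preimage ℓ K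
  ∈-preimage⁺ {K} = ∈-tabulate-dec⁺ (λ v → ℓ v ∈? K)

  ∈-preimage⁻ : ∀ {K v} → v ∈ preimage ℓ K → ℓ v ∈ K
  ∈-preimage⁻ {K} = ∈-tabulate-dec⁻ (λ v → ℓ v ∈? K)

  type-mono : ∀ {F G} → F ⊆ G → type ℓ F ⊆ type ℓ G
  type-mono F⊆G i∈ with ∈-type⁻ i∈
  ... | v , v∈F , refl = ∈-type⁺ (F⊆G v∈F)

  type⊆⇒⊆preimage : ∀ {F K} → type ℓ F ⊆ K → F ⊆ preimage ℓ K
  type⊆⇒⊆preimage typeF⊆K v∈F = ∈-preimage⁺ (typeF⊆K (∈-type⁺ v∈F))

  type-∩-preimage : ∀ {D} K → (∀ i → ∃[ v ] (v ∈ D × ℓ v ≡ i)) →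
                    type ℓ (D ∩ preimage ℓ K) ≡ K
  type-∩-preimage {D} K onto = ⊆-antisym ⊆K K⊆
    where
    ⊆K : type ℓ (D ∩ preimage ℓ K) ⊆ K
    ⊆K i∈ with ∈-type⁻ i∈
    ... | v , v∈ , refl = ∈-preimage⁻ (proj₂ (x∈p∩q⁻ D _ v∈))
    K⊆ : K ⊆ type ℓ (D ∩ preimage ℓ K)
    K⊆ {i} i∈K with onto i
    ... | v , v∈D , refl = ∈-type⁺ (x∈p∩q⁺ (v∈D , ∈-preimage⁺ i∈K))

  module _ {D : Subset n} (injective : ∀ {u v} → u ∈ D → v ∈ D → ℓ u ≡ ℓ v → u ≡ v) where

    type-reflects-⊆ : ∀ {F G} → F ⊆ D → G ⊆ D → type ℓ F ⊆ type ℓ G → F ⊆ G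
    type-reflects-⊆ F⊆D G⊆D typeF⊆typeG v∈F with ∈-type⁻ (typeF⊆typeG (∈-type⁺ v∈F))
    ... | u , u∈G , ℓu≡ℓv = subst (_∈ _) (injective (G⊆D u∈G) (F⊆D v∈F) ℓu≡ℓv) u∈G

    type-injective : ∀ {F G} → F ⊆ D → G ⊆ D → type ℓ F ≡ type ℓ G → F ≡ G
    type-injective F⊆D G⊆D eq = ⊆-antisym
      (type-reflects-⊆ F⊆D G⊆D (⊆-reflexive eq))
      (type-reflects-⊆ G⊆D F⊆D (⊆-reflexive (sym eq)))

module _ {n m : ℕ} (Δ : SimplicialComplex n) (ℓ : Fin n → Fin m) (labelling : IsLabelling Δ ℓ)
         (R : Subset n → Subset n → Subset n) (restriction : IsRestriction Δ R)
         {C : Subset n} (chamber-C : IsChamber Δ C) where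

  open IsRestriction restriction

  InInterval : Subset n → Subset n → Set
  InInterval D F = (IsChamber Δ D × R C D ⊆ F) × F ⊆ D

  inInterval? : ∀ D F → Dec (InInterval D F)
  inInterval? D F = (isChamber? Δ D ×-dec (R C D ⊆? F)) ×-dec (F ⊆? D)

  face-in-unique-interval : ∀ K F →
    𝟙 (isFace? Δ F ×-dec (type ℓ F ≟ˢ K)) ≡ ∑[ D ] 𝟙 (inInterval? D F ×-dec (type ℓ F ≟ˢ K))
  face-in-unique-interval K F = sym (∑-𝟙-unique
    (λ D → inInterval? D F ×-dec (type ℓ F ≟ˢ K)) (isFace? Δ F ×-dec (type ℓ F ≟ˢ K))
    (λ { (((chD , R⊆F) , F⊆D) , _) (((chD′ , R′⊆F) , F⊆D′) , _) →
         R2-unique chamber-C chD chD′ R⊆F F⊆D R′⊆F F⊆D′ })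
    (mk⇔ to from))
    where
    to : ∃[ D ] (InInterval D F × type ℓ F ≡ K) → IsFace Δ F × type ℓ F ≡ K
    to (D , ((chD , _) , F⊆D) , typeF≡K) = down-closed Δ (proj₁ chD) F⊆D , typeF≡K
    from : IsFace Δ F × type ℓ F ≡ K → ∃[ D ] (InInterval D F × type ℓ F ≡ K)
    from (faceF , typeF≡K) with R2-cover chamber-C faceF
    ... | D , chD , R⊆F , F⊆D = D , ((chD , R⊆F) , F⊆D) , typeF≡K

  ∑-faces-of-type-in-interval : ∀ K D →
    ∑[ F ] 𝟙 (inInterval? D F ×-dec (type ℓ F ≟ˢ K)) ≡
    𝟙 (isChamber? Δ D ×-dec (type ℓ (R C D) ⊆? K))
  ∑-faces-of-type-in-interval K D = ∑-𝟙-unique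
    (λ F → inInterval? D F ×-dec (type ℓ F ≟ˢ K)) (isChamber? Δ D ×-dec (type ℓ (R C D) ⊆? K))
    (λ { (((chD , _) , F⊆D) , typeF≡K) ((_ , G⊆D) , typeG≡K) →
         type-injective ℓ (proj₂ (labelling chD)) F⊆D G⊆D (trans typeF≡K (sym typeG≡K)) })
    (mk⇔ to from)
    where
    to : ∃[ F ] (InInterval D F × type ℓ F ≡ K) → IsChamber Δ D × type ℓ (R C D) ⊆ K
    to (F , ((chD , R⊆F) , _) , typeF≡K) = chD , λ i∈ → subst (_ ∈_) typeF≡K (type-mono ℓ R⊆F i∈)
    from : IsChamber Δ D × type ℓ (R C D) ⊆ K → ∃[ F ] (InInterval D F × type ℓ F ≡ K)
    from (chD , typeR⊆K) =
      D ∩ preimage ℓ K , ((chD , R⊆F) , p∩q⊆p D _) , type-∩-preimage ℓ K (proj₁ (labelling chD))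
      where
      R⊆F : R C D ⊆ D ∩ preimage ℓ K
      R⊆F v∈R = x∈p∩q⁺ (R1-le chamber-C chD v∈R , type⊆⇒⊆preimage ℓ typeR⊆K v∈R)

  chamber-of-type? : ∀ L D → Dec (IsChamber Δ D × type ℓ (R C D) ≡ L)
  chamber-of-type? L D = isChamber? Δ D ×-dec (type ℓ (R C D) ≟ˢ L)

  split-by-type : ∀ K D →
    𝟙 (isChamber? Δ D ×-dec (type ℓ (R C D) ⊆? K)) ≡ ∑[ L ] 𝟙 ((L ⊆? K) ×-dec chamber-of-type? L D)
  split-by-type K D = sym (∑-𝟙-unique
    (λ L → (L ⊆? K) ×-dec chamber-of-type? L D) (isChamber? Δ D ×-dec (type ℓ (R C D) ⊆? K))
    (λ { (_ , _ , refl) (_ , _ , refl) → refl })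
    (mk⇔ to from))
    where
    to : ∃[ L ] (L ⊆ K × IsChamber Δ D × type ℓ (R C D) ≡ L) → IsChamber Δ D × type ℓ (R C D) ⊆ K
    to (_ , L⊆K , chD , refl) = chD , L⊆K
    from : IsChamber Δ D × type ℓ (R C D) ⊆ K → ∃[ L ] (L ⊆ K × IsChamber Δ D × type ℓ (R C D) ≡ L)
    from (chD , typeR⊆K) = type ℓ (R C D) , typeR⊆K , chD , refl

  flagF≡∑beta : ∀ K → + flagF Δ ℓ K ≡ ∑[ L ] 𝟙 (L ⊆? K) * + beta Δ ℓ R C L
  flagF≡∑beta K = begin
    + flagF Δ ℓ K
      ≡⟨ +-countSubsets (λ F → isFace? Δ F ×-dec (type ℓ F ≟ˢ K)) ⟩
    ∑[ F ] 𝟙 (isFace? Δ F ×-dec (type ℓ F ≟ˢ K))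
      ≡⟨ ∑-cong (face-in-unique-interval K) ⟩
    ∑[ F ] ∑[ D ] 𝟙 (inInterval? D F ×-dec (type ℓ F ≟ˢ K))
      ≡⟨ ∑-comm (λ F D → 𝟙 (inInterval? D F ×-dec (type ℓ F ≟ˢ K))) ⟩
    ∑[ D ] ∑[ F ] 𝟙 (inInterval? D F ×-dec (type ℓ F ≟ˢ K))
      ≡⟨ ∑-cong (∑-faces-of-type-in-interval K) ⟩
    ∑[ D ] 𝟙 (isChamber? Δ D ×-dec (type ℓ (R C D) ⊆? K))
      ≡⟨ ∑-cong (split-by-type K) ⟩
    ∑[ D ] ∑[ L ] 𝟙 ((L ⊆? K) ×-dec chamber-of-type? L D)
      ≡⟨ ∑-comm (λ D L → 𝟙 ((L ⊆? K) ×-dec chamber-of-type? L D)) ⟩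
    ∑[ L ] ∑[ D ] 𝟙 ((L ⊆? K) ×-dec chamber-of-type? L D)
      ≡⟨ ∑-cong factor ⟩
    ∑[ L ] 𝟙 (L ⊆? K) * (∑[ D ] 𝟙 (chamber-of-type? L D))
      ≡⟨ ∑-cong (λ L → cong (𝟙 (L ⊆? K) *_) (+-countSubsets (chamber-of-type? L))) ⟨
    ∑[ L ] 𝟙 (L ⊆? K) * + beta Δ ℓ R C L ∎
    where
    factor : ∀ L → ∑[ D ] 𝟙 ((L ⊆? K) ×-dec chamber-of-type? L D) ≡
                   𝟙 (L ⊆? K) * (∑[ D ] 𝟙 (chamber-of-type? L D))
    factor L = trans (∑-cong (λ D → 𝟙-× (L ⊆? K) (chamber-of-type? L D)))
                     (∑-*ˡ (𝟙 (L ⊆? K)) (𝟙 ∘ chamber-of-type? L))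

proposition7p3 : ∀ {n m : ℕ} (Δ : SimplicialComplex n) → IsPure Δ →
    (ℓ : Fin n → Fin m) → IsLabelling Δ ℓ →
    (R : Subset n → Subset n → Subset n) → IsRestriction Δ R →
    ∀ (C : Subset n) → IsChamber Δ C →
    ∀ (J : Subset m) → + beta Δ ℓ R C J ≡ flagH Δ ℓ J
proposition7p3 Δ _ ℓ labelling R restriction C chamber-C J =
  sym (möbius-inversion (λ K → + flagF Δ ℓ K) (λ L → + beta Δ ℓ R C L)
                        (flagF≡∑beta Δ ℓ labelling R restriction chamber-C) J)
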